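{- For every $n\ge1$, \[\sum_T a^{\,n-\mathrm{prop}\,T}\,b^{\,\mathrm{prop}\,T-1}=Q_n(a,b)=\prod_{i=1}^{n-1}(ia+(n-i)b),\] where $T$ runs over all rooted trees on the vertex set $[n]$ and $\mathrm{prop}\,T$ is the number of proper vertices of $T$.
   Context: A vertex $w$ is a descendant of $v$ if $v$ lies on the path from the root to $w$; a proper descendant if moreover $w\ne v$. A vertex of a tree with vertex set $[n]$ is proper if it is less than all its proper descendants. -}

module Defs where

open import Level using (Level)
open import Data.Nat using (ℕ; zero; suc; _∸_; _≤_)
open import Data.Fin using (Fin; toℕ; _<_)
open import Data.Fin.Properties using (_≟_; any?; all?; _<?_)
open import Data.List using (List; []; _∷_; map; concatMap; filter; length; foldr; upTo; allFin)
open import Data.Product using (Σ; _×_; _,_)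
open import Data.Vec.Functional using (Vector) renaming (_∷_ to _∷ᶠ_; [] to []ᶠ)
open import Relation.Binary.PropositionalEquality using (_≡_; _≢_)
open import Relation.Nullary using (Dec; ¬_)
open import Relation.Nullary.Decidable using (_×-dec_; _→-dec_; ¬?)
open import Algebra.Bundles using (CommutativeSemiring)

iter : {A : Set} → (A → A) → ℕ → A → A
iter f zero    x = x
iter f (suc k) x = f (iter f k x)

-- A rooted tree on the vertex set [n] = Fin n is encoded by its parent
-- function f : Fin n → Fin n, with the convention that the root r is the
-- unique vertex with f r ≡ r.  f is a rooted tree iff there is a vertex r
-- with f r ≡ r such that every vertex reaches r by following parents
-- (n steps always suffice).  This is a bijective encoding of rooted
-- labelled trees on [n].
IsRootedTree : (n : ℕ) → (Fin n → Fin n) → Set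
IsRootedTree n f = Σ (Fin n) λ r → (f r ≡ r) × (∀ v → iter f n v ≡ r)

isRootedTree? : (n : ℕ) → (f : Fin n → Fin n) → Dec (IsRootedTree n f)
isRootedTree? n f = any? λ r → (f r ≟ r) ×-dec all? (λ v → iter f n v ≟ r)

Descendant : (n : ℕ) → (Fin n → Fin n) → Fin n → Fin n → Set
Descendant n f v w = Σ (Fin (suc n)) λ k → iter f (toℕ k) w ≡ v

descendant? : (n : ℕ) → (f : Fin n → Fin n) → ∀ v w → Dec (Descendant n f v w)
descendant? n f v w = any? λ k → iter f (toℕ k) w ≟ v

IsProper : (n : ℕ) → (Fin n → Fin n) → Fin n → Set
IsProper n f v = ∀ w → Descendant n f v w → w ≢ v → v < w

isProper? : (n : ℕ) → (f : Fin n → Fin n) → ∀ v → Dec (IsProper n f v)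
isProper? n f v = all? λ w → descendant? n f v w →-dec (¬? (w ≟ v) →-dec (v <? w))

prop : (n : ℕ) → (Fin n → Fin n) → ℕ
prop n f = length (filter (isProper? n f) (allFin n))

allFuns : (k n : ℕ) → List (Fin k → Fin n)
allFuns zero    n = (λ ()) ∷ []
allFuns (suc k) n = concatMap (λ x → map (λ g → x ∷ᶠ g) (allFuns k n)) (allFin n)

rootedTrees : (n : ℕ) → List (Fin n → Fin n)
rootedTrees n = filter (isRootedTree? n) (allFuns n n)

module _ {c ℓ : Level} (R : CommutativeSemiring c ℓ) where
  open CommutativeSemiring R
  open import Algebra.Definitions.RawSemiring rawSemiring using (_^_) renaming (_×_ to _·ℕ_)

  ∑ : List Carrier → Carrier
  ∑ = foldr _+_ 0#

  ∏ : List Carrier → Carrier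
  ∏ = foldr _*_ 1#

  treeSum : ℕ → Carrier → Carrier → Carrier
  treeSum n a b = ∑ (map (λ t → (a ^ (n ∸ prop n t)) * (b ^ (prop n t ∸ 1))) (rootedTrees n))

  Q : ℕ → Carrier → Carrier → Carrier
  Q n a b = ∏ (map (λ j → (suc j ·ℕ a) + ((n ∸ suc j) ·ℕ b)) (upTo (n ∸ 1)))

-- Weight each non-root vertex of a rooted forest on [N] by b if it is proper and by a
-- otherwise, except that vertex 0, which is always proper, gets weight 1.  Fix a root set S
-- with t elements and s + 1 non-roots, the least non-root m, and a root d.  In a forest
-- where m lies in the tree of d, let x be the child of d on the path from m.  Cutting the
-- edge x → d is a bijection onto the forests with roots S ∪ {x} in which m lies in the tree
-- of x, and it only removes the factor of x: the weight w(m) (1 if m = 0, else b) if x = m,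
-- and a otherwise, as then m < x lies below x.  Writing F(S, d) for the weighted count,
--   F(S, d) = w(m) · Σ_{d′ ∈ S ∪ {m}} F(S ∪ {m}, d′) + a · Σ_{x ∉ S ∪ {m}} F(S ∪ {x}, x),
-- and induction on s gives F(S, d) = w(m) ∏_{j=1}^{s} (j a + (s + t + 1 − j) b) for every
-- root d.  A tree with root r is a forest with root set {r} whose root weighs 1 if r = 0
-- and a otherwise; summing over r gives Q_n(a, b).

module Submission where

open import Defs
open import Level using (Level)
open import Data.Nat using (ℕ; _≥_)
open import Algebra.Bundles using (CommutativeSemiring; CommutativeMonoid)

open import Data.Nat as ℕ using (zero; suc; _∸_; z≤n; s≤s)
import Data.Nat.Properties as ℕ
open import Data.Fin as Fin using (Fin; toℕ; fromℕ<)
import Data.Fin.Properties as Fin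
open import Data.Bool using (Bool; true; false; if_then_else_; not)
import Data.Bool.Properties as Bool
open import Data.Product using (_×_; _,_; proj₁; proj₂; ∃-syntax)
open import Data.Sum using (_⊎_; inj₁; inj₂)
open import Data.List using (List; []; _∷_; _++_; [_]; foldr; map; concatMap; filter; length; tabulate; allFin; upTo)
import Data.List.Properties as List
open import Data.Vec.Functional using (Vector; tail; updateAt) renaming (_∷_ to _∷ᶠ_)
open import Data.Vec.Functional.Properties using (updateAt-updates; updateAt-minimal)
open import Function using (_∘_; const; _⇔_; mk⇔; Equivalence)
open import Relation.Binary using (tri<; tri≈; tri>)
open import Relation.Binary.PropositionalEquality
  using (_≡_; _≢_; _≗_; refl; sym; trans; cong; cong₂; subst; module ≡-Reasoning)
open import Relation.Nullary using (Dec; does; yes; no; ¬_; contradiction)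
open import Relation.Nullary.Decidable as Dec using (_×-dec_; _→-dec_; ¬?)

module _ {A : Set} (f : A → A) where
  open import Data.Nat using (_+_)
  open ≡-Reasoning

  iter-+ : ∀ p q v → iter f (p + q) v ≡ iter f p (iter f q v)
  iter-+ zero    q v = refl
  iter-+ (suc p) q v = cong f (iter-+ p q v)

  iter-fixed : ∀ {s} → f s ≡ s → ∀ k → iter f k s ≡ s
  iter-fixed fs zero    = refl
  iter-fixed fs (suc k) = trans (cong f (iter-fixed fs k)) fs

  iter-stays : ∀ {j k v s} → j ℕ.≤ k → iter f j v ≡ s → f s ≡ s → iter f k v ≡ s
  iter-stays {j} {k} {v} {s} j≤k fʲv≡s fs≡s = begin
    iter f k v                  ≡⟨ cong (λ i → iter f i v) (ℕ.m∸n+n≡m j≤k) ⟨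
    iter f ((k ∸ j) + j) v      ≡⟨ iter-+ (k ∸ j) j v ⟩
    iter f (k ∸ j) (iter f j v) ≡⟨ cong (iter f (k ∸ j)) fʲv≡s ⟩
    iter f (k ∸ j) s            ≡⟨ iter-fixed fs≡s (k ∸ j) ⟩
    s                           ∎

iter-cong : {A : Set} {f g : A → A} → f ≗ g → ∀ k → iter f k ≗ iter g k
iter-cong f≗g zero    v = refl
iter-cong {g = g} f≗g (suc k) v = trans (f≗g _) (cong g (iter-cong f≗g k v))

module _ {N : ℕ} (f : Fin N → Fin N) where
  open import Data.Nat using (_+_)
  open ≡-Reasoning

  iter-suc-N-repeats : ∀ v → ∃[ k ] (k ℕ.≤ N × iter f (suc N) v ≡ iter f k v)
  iter-suc-N-repeats v
    with i , j , i<j , fⁱv≡fʲv ← Fin.pigeonhole (ℕ.n<1+n N) (λ (i : Fin (suc N)) → iter f (toℕ i) v)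
    = (suc N ∸ J) + I , k≤N , (begin
      iter f (suc N) v                ≡⟨ cong (λ k → iter f k v) (ℕ.m∸n+n≡m J≤1+N) ⟨
      iter f ((suc N ∸ J) + J) v      ≡⟨ iter-+ f (suc N ∸ J) J v ⟩
      iter f (suc N ∸ J) (iter f J v) ≡⟨ cong (iter f (suc N ∸ J)) fⁱv≡fʲv ⟨
      iter f (suc N ∸ J) (iter f I v) ≡⟨ iter-+ f (suc N ∸ J) I v ⟨
      iter f ((suc N ∸ J) + I) v      ∎)
    where
    I J : ℕ
    I = toℕ i
    J = toℕ j
    J≤1+N : J ℕ.≤ suc N
    J≤1+N = ℕ.<⇒≤ (Fin.toℕ<n j)
    k≤N : (suc N ∸ J) + I ℕ.≤ N
    k≤N = ℕ.≤-pred (ℕ.≤-trans (ℕ.+-monoʳ-< (suc N ∸ J) i<j) (ℕ.≤-reflexive (ℕ.m∸n+n≡m J≤1+N)))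

  iter-within-N : ∀ k v → ∃[ k′ ] (k′ ℕ.≤ N × iter f k v ≡ iter f k′ v)
  iter-within-N zero    v = 0 , z≤n , refl
  iter-within-N (suc k) v with iter-within-N k v
  ... | k′ , k′≤N , fᵏv≡fᵏ′v with ℕ.m≤n⇒m<n∨m≡n k′≤N
  ...   | inj₁ k′<N = suc k′ , k′<N , cong f fᵏv≡fᵏ′v
  ...   | inj₂ refl with k″ , k″≤N , eq ← iter-suc-N-repeats v = k″ , k″≤N , trans (cong f fᵏv≡fᵏ′v) eq

  fixed-point-reached-within-N : ∀ {k v s} → f s ≡ s → iter f k v ≡ s → iter f N v ≡ s
  fixed-point-reached-within-N {k} {v} fs≡s fᵏv≡s with k′ , k′≤N , eq ← iter-within-N k v =
    iter-stays f k′≤N (trans (sym eq) fᵏv≡s) fs≡s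

  module _ {g : Fin N → Fin N} {x : Fin N} (f≡g : ∀ i → i ≢ x → f i ≡ g i) where

    iter-agree-until-hit : ∀ k v → iter f k v ≡ iter g k v ⊎ ∃[ j ] (j ℕ.≤ k × iter f j v ≡ x)
    iter-agree-until-hit zero    v = inj₁ refl
    iter-agree-until-hit (suc k) v with iter-agree-until-hit k v
    ... | inj₂ (j , j≤k , fʲv≡x) = inj₂ (j , ℕ.m≤n⇒m≤1+n j≤k , fʲv≡x)
    ... | inj₁ eq with iter f k v Fin.≟ x
    ...   | yes fᵏv≡x = inj₂ (k , ℕ.n≤1+n k , fᵏv≡x)
    ...   | no  fᵏv≢x = inj₁ (trans (f≡g _ fᵏv≢x) (cong g eq))

    iter-redirect : ∀ {d} → f x ≡ d → g x ≡ x → f d ≡ d →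
                    ∀ k v → iter f k v ≡ iter g k v ⊎ (iter f k v ≡ d × iter g k v ≡ x)
    iter-redirect fx≡d gx≡x fd≡d zero    v = inj₁ refl
    iter-redirect fx≡d gx≡x fd≡d (suc k) v with iter-redirect fx≡d gx≡x fd≡d k v
    ... | inj₂ (fᵏv≡d , gᵏv≡x) = inj₂ (trans (cong f fᵏv≡d) fd≡d , trans (cong g gᵏv≡x) gx≡x)
    ... | inj₁ eq with iter f k v Fin.≟ x
    ...   | yes fᵏv≡x = inj₂ (trans (cong f fᵏv≡x) fx≡d , trans (cong g (trans (sym eq) fᵏv≡x)) gx≡x)
    ...   | no  fᵏv≢x = inj₁ (trans (f≡g _ fᵏv≢x) (cong g eq))

module _ {c ℓ : Level} (M : CommutativeMonoid c ℓ) where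
  open CommutativeMonoid M renaming (refl to ≈-refl; sym to ≈-sym; trans to ≈-trans)
  open import Algebra.Properties.CommutativeMonoid.Sum M using (sum; sum-cong-≋; sum-replicate-zero)
  open import Algebra.Solver.CommutativeMonoid M using (solve; _⊕_; _⊜_)
  open import Relation.Binary.Reasoning.Setoid setoid

  sum-exchange : ∀ {n} (t u : Vector Carrier n) x → (∀ i → i ≢ x → t i ≈ u i) →
                 sum t ∙ u x ≈ t x ∙ sum u
  sum-exchange t u Fin.zero t≈u = begin
    (t Fin.zero ∙ sum (tail t)) ∙ u Fin.zero
      ≈⟨ ∙-congʳ (∙-congˡ (sum-cong-≋ (λ i → t≈u (Fin.suc i) λ ()))) ⟩
    (t Fin.zero ∙ sum (tail u)) ∙ u Fin.zero
      ≈⟨ solve 3 (λ x y z → (x ⊕ y) ⊕ z ⊜ x ⊕ (z ⊕ y)) ≈-refl _ _ _ ⟩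
    t Fin.zero ∙ (u Fin.zero ∙ sum (tail u)) ∎
  sum-exchange t u (Fin.suc x) t≈u = begin
    (t Fin.zero ∙ sum (tail t)) ∙ u (Fin.suc x)
      ≈⟨ assoc _ _ _ ⟩
    t Fin.zero ∙ (sum (tail t) ∙ u (Fin.suc x))
      ≈⟨ ∙-congˡ (sum-exchange (tail t) (tail u) x (λ i i≢x → t≈u (Fin.suc i) (i≢x ∘ Fin.suc-injective))) ⟩
    t Fin.zero ∙ (t (Fin.suc x) ∙ sum (tail u))
      ≈⟨ solve 3 (λ x y z → x ⊕ (y ⊕ z) ⊜ y ⊕ (x ⊕ z)) ≈-refl _ _ _ ⟩
    t (Fin.suc x) ∙ (t Fin.zero ∙ sum (tail u))
      ≈⟨ ∙-congˡ (∙-congʳ (t≈u Fin.zero λ ())) ⟩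
    t (Fin.suc x) ∙ (u Fin.zero ∙ sum (tail u)) ∎

  foldr-++ : ∀ xs ys → foldr _∙_ ε (xs ++ ys) ≈ foldr _∙_ ε xs ∙ foldr _∙_ ε ys
  foldr-++ []       ys = ≈-sym (identityˡ _)
  foldr-++ (x ∷ xs) ys = ≈-trans (∙-congˡ (foldr-++ xs ys)) (≈-sym (assoc _ _ _))

  sum-zero : ∀ {n} (t : Vector Carrier n) → (∀ i → t i ≈ ε) → sum t ≈ ε
  sum-zero {n} t t≈ε = ≈-trans (sum-cong-≋ t≈ε) (sum-replicate-zero n)

  sum-single : ∀ {n} (t : Vector Carrier n) x → (∀ i → i ≢ x → t i ≈ ε) → sum t ≈ t x
  sum-single {n} t x t≈ε = begin
    sum t               ≈⟨ identityʳ _ ⟨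
    sum t ∙ ε           ≈⟨ sum-exchange t (λ _ → ε) x t≈ε ⟩
    t x ∙ sum {n} (λ _ → ε) ≈⟨ ∙-congˡ (sum-replicate-zero n) ⟩
    t x ∙ ε             ≈⟨ identityʳ _ ⟩
    t x                 ∎

-- Subsets of Fin n as Boolean predicates

member≢nonmember : {A : Set} {S : A → Bool} {v w : A} → S v ≡ true → S w ≡ false → v ≢ w
member≢nonmember Sv≡true Sw≡false refl = contradiction (trans (sym Sv≡true) Sw≡false) λ ()

rising-edge : (p : ℕ → Bool) → p 0 ≡ false → ∀ M → p M ≡ true →
              ∃[ k ] (k ℕ.< M × p k ≡ false × p (suc k) ≡ true)
rising-edge p p0≡false zero    pM≡true = contradiction (trans (sym p0≡false) pM≡true) λ ()
rising-edge p p0≡false (suc M) pM≡true with p M in pM≡b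
... | false = M , ℕ.≤-refl , pM≡b , pM≡true
... | true with k , k<M , rest ← rising-edge p p0≡false M pM≡b = k , ℕ.m≤n⇒m≤1+n k<M , rest

open import Algebra.Properties.CommutativeMonoid.Sum ℕ.+-0-commutativeMonoid using () renaming (sum to ℕsum)

indicator : Bool → ℕ
indicator β = if β then 1 else 0

count : ∀ {n} → (Fin n → Bool) → ℕ
count p = ℕsum (indicator ∘ p)

count-exchange : ∀ {n} (p q : Fin n → Bool) x → (∀ i → i ≢ x → p i ≡ q i) →
                 count p ℕ.+ indicator (q x) ≡ indicator (p x) ℕ.+ count q
count-exchange p q x p≡q =
  sum-exchange ℕ.+-0-commutativeMonoid _ _ x (λ i i≢x → cong indicator (p≡q i i≢x))

count-≤ : ∀ {n} (p : Fin n → Bool) → count p ℕ.≤ n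
count-≤ {zero}  p = z≤n
count-≤ {suc n} p with p Fin.zero
... | true  = s≤s (count-≤ (p ∘ Fin.suc))
... | false = ℕ.m≤n⇒m≤1+n (count-≤ (p ∘ Fin.suc))

count≡0⇒false : ∀ {n} (p : Fin n → Bool) → count p ≡ 0 → ∀ x → p x ≡ false
count≡0⇒false {suc n} p count≡0 x with p Fin.zero in p₀ | x
... | true  | _          = contradiction count≡0 λ ()
... | false | Fin.zero    = p₀
... | false | Fin.suc x′ = count≡0⇒false (p ∘ Fin.suc) count≡0 x′

count-true : ∀ n → count {n} (const true) ≡ n
count-true zero    = refl
count-true (suc n) = cong suc (count-true n)

count-false : ∀ n → count {n} (const false) ≡ 0
count-false zero    = refl
count-false (suc n) = count-false n

length-filter-tabulate : ∀ {A : Set} {P : A → Set} (P? : ∀ x → Dec (P x)) {n} (g : Fin n → A) →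
                         length (filter P? (tabulate g)) ≡ count (λ i → does (P? (g i)))
length-filter-tabulate P? {zero}  g = refl
length-filter-tabulate P? {suc n} g with does (P? (g Fin.zero))
... | true  = cong suc (length-filter-tabulate P? (g ∘ Fin.suc))
... | false = length-filter-tabulate P? (g ∘ Fin.suc)

insert : ∀ {n} → (Fin n → Bool) → Fin n → (Fin n → Bool)
insert S x = updateAt S x (const true)

insert-self : ∀ {n} (S : Fin n → Bool) x → insert S x x ≡ true
insert-self S x = updateAt-updates x S

insert-≢ : ∀ {n} (S : Fin n → Bool) {x i} → i ≢ x → insert S x i ≡ S i
insert-≢ S {x} {i} = updateAt-minimal i x S

count-insert : ∀ {n} (S : Fin n → Bool) {x} → S x ≡ false → count (insert S x) ≡ suc (count S)
count-insert S {x} Sx≡false = begin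
  count (insert S x)                     ≡⟨ cong (λ β → indicator β ℕ.+ count (insert S x)) Sx≡false ⟨
  indicator (S x) ℕ.+ count (insert S x) ≡⟨ count-exchange S (insert S x) x (λ i i≢x → sym (insert-≢ S i≢x)) ⟨
  count S ℕ.+ indicator (insert S x x)   ≡⟨ cong (λ β → count S ℕ.+ indicator β) (insert-self S x) ⟩
  count S ℕ.+ 1                          ≡⟨ ℕ.+-comm (count S) 1 ⟩
  suc (count S)                          ∎
  where open ≡-Reasoning

count-not-insert : ∀ {n} (S : Fin n → Bool) {x} → S x ≡ false → count (not ∘ S) ≡ suc (count (not ∘ insert S x))
count-not-insert S {x} Sx≡false = begin
  count (not ∘ S)
    ≡⟨ ℕ.+-identityʳ _ ⟨
  count (not ∘ S) ℕ.+ 0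
    ≡⟨ cong (λ β → count (not ∘ S) ℕ.+ indicator (not β)) (insert-self S x) ⟨
  count (not ∘ S) ℕ.+ indicator (not (insert S x x))
    ≡⟨ count-exchange (not ∘ S) (not ∘ insert S x) x (λ i i≢x → cong not (sym (insert-≢ S i≢x))) ⟩
  indicator (not (S x)) ℕ.+ count (not ∘ insert S x)
    ≡⟨ cong (λ β → indicator (not β) ℕ.+ count (not ∘ insert S x)) Sx≡false ⟩
  suc (count (not ∘ insert S x)) ∎
  where open ≡-Reasoning

IsLeastOutside : ∀ {n} → (Fin n → Bool) → Fin n → Set
IsLeastOutside S m = S m ≡ false × (∀ v → S v ≡ false → m Fin.≤ v)

leastOutside : ∀ {n s} (S : Fin n → Bool) → count (not ∘ S) ≡ suc s → ∃[ m ] IsLeastOutside S m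
leastOutside {suc n} S #outside with S Fin.zero in S₀
... | false = Fin.zero , S₀ , λ _ _ → z≤n
... | true with m , Sm≡false , least ← leastOutside (S ∘ Fin.suc) #outside =
  Fin.suc m , Sm≡false , λ { Fin.zero Sv≡false → contradiction (trans (sym S₀) Sv≡false) λ ()
                           ; (Fin.suc v) Sv≡false → s≤s (least v Sv≡false) }

leastOutside-insert : ∀ {n} {S : Fin n → Bool} {m x} → IsLeastOutside S m → x ≢ m → IsLeastOutside (insert S x) m
leastOutside-insert {S = S} {m} {x} (Sm≡false , least) x≢m =
  trans (insert-≢ S (x≢m ∘ sym)) Sm≡false ,
  λ v S′v≡false →
    least v (trans (sym (insert-≢ S (member≢nonmember (insert-self S x) S′v≡false ∘ sym))) S′v≡false)

module _ {c ℓ : Level} (R : CommutativeSemiring c ℓ) where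
  open CommutativeSemiring R renaming (refl to ≈-refl; sym to ≈-sym; trans to ≈-trans)
  open import Algebra.Properties.Semiring.Sum semiring
    using (sum; sum-syntax; sum-cong-≋; sum-replicate; ∑-comm; *-distribˡ-sum)
  open import Algebra.Definitions.RawSemiring rawSemiring using (_^_) renaming (_×_ to _·ℕ_)
  open import Algebra.Properties.Semiring.Mult semiring using (×-assoc-*; ×-congʳ; ×-homo-1)
  open import Relation.Binary.Reasoning.Setoid setoid

  when : {P : Set} → Dec P → Carrier → Carrier
  when (yes _) x = x
  when (no _)  _ = 0#

  when-yes : {P : Set} (P? : Dec P) {x : Carrier} → P → when P? x ≈ x
  when-yes (yes _) p = ≈-refl
  when-yes (no ¬p) p = contradiction p ¬p

  when-no : {P : Set} (P? : Dec P) {x : Carrier} → ¬ P → when P? x ≈ 0#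
  when-no (yes p) ¬p = contradiction p ¬p
  when-no (no _)  ¬p = ≈-refl

  when-cong : {P Q : Set} (P? : Dec P) (Q? : Dec Q) {x y : Carrier} →
              P ⇔ Q → (P → x ≈ y) → when P? x ≈ when Q? y
  when-cong (yes p) (yes q) P⇔Q x≈y = x≈y p
  when-cong (yes p) (no ¬q) P⇔Q x≈y = contradiction (Equivalence.to P⇔Q p) ¬q
  when-cong (no ¬p) (yes q) P⇔Q x≈y = contradiction (Equivalence.from P⇔Q q) ¬p
  when-cong (no ¬p) (no ¬q) P⇔Q x≈y = ≈-refl

  when-elim : {P : Set} (P? : Dec P) {x y : Carrier} → (P → x ≈ y) → (¬ P → 0# ≈ y) → when P? x ≈ y
  when-elim (yes p)  if-yes if-no = if-yes p
  when-elim (no ¬p)  if-yes if-no = if-no ¬p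

  when-implied : {P Q : Set} (P? : Dec P) (Q? : Dec Q) {x : Carrier} → (P → Q) → when Q? (when P? x) ≈ when P? x
  when-implied (yes p) Q? P→Q = when-yes Q? (P→Q p)
  when-implied (no _)  (yes _) P→Q = ≈-refl
  when-implied (no _)  (no _)  P→Q = ≈-refl

  when-congʳ : {P : Set} (P? : Dec P) {x y : Carrier} → x ≈ y → when P? x ≈ when P? y
  when-congʳ (yes _) x≈y = x≈y
  when-congʳ (no _)  x≈y = ≈-refl

  *-distribˡ-when : {P : Set} (P? : Dec P) (z x : Carrier) → z * when P? x ≈ when P? (z * x)
  *-distribˡ-when (yes _) z x = ≈-refl
  *-distribˡ-when (no _)  z x = zeroʳ z

  sum-when-≟ : ∀ {n} (t : Vector Carrier n) x → ∑[ i < n ] when (i Fin.≟ x) (t i) ≈ t x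
  sum-when-≟ t x = ≈-trans (sum-single +-commutativeMonoid _ x (λ i i≢x → when-no (i Fin.≟ x) i≢x))
                           (when-yes (x Fin.≟ x) refl)

  sum-count : ∀ {n} (p : Fin n → Bool) (t : Vector Carrier n) {y : Carrier} →
              (∀ i → p i ≡ true → t i ≈ y) → (∀ i → p i ≡ false → t i ≈ 0#) →
              sum t ≈ count p ·ℕ y
  sum-count {zero}  p t on off = ≈-refl
  sum-count {suc n} p t on off with p Fin.zero in p₀
  ... | true  = +-cong (on _ p₀) (sum-count (p ∘ Fin.suc) (tail t) (on ∘ Fin.suc) (off ∘ Fin.suc))
  ... | false = ≈-trans (+-cong (off _ p₀) (sum-count (p ∘ Fin.suc) (tail t) (on ∘ Fin.suc) (off ∘ Fin.suc)))
                        (+-identityˡ _)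

  sum-split-at : ∀ {n} (t : Vector Carrier n) x → sum t ≈ t x + ∑[ i < n ] when (¬? (i Fin.≟ x)) (t i)
  sum-split-at t x = begin
    sum t
      ≈⟨ +-identityʳ _ ⟨
    sum t + 0#
      ≈⟨ +-congˡ (when-no (¬? (x Fin.≟ x)) (λ x≢x → x≢x refl)) ⟨
    sum t + when (¬? (x Fin.≟ x)) (t x)
      ≈⟨ sum-exchange +-commutativeMonoid _ _ x (λ i i≢x → ≈-sym (when-yes (¬? (i Fin.≟ x)) i≢x)) ⟩
    t x + ∑[ i < _ ] when (¬? (i Fin.≟ x)) (t i) ∎

  collect-× : ∀ (w x y F : Carrier) u v →
              w * (u ·ℕ (y * F)) + v ·ℕ (x * (w * F)) ≈ w * ((v ·ℕ x + u ·ℕ y) * F)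
  collect-× w x y F u v = begin
    w * (u ·ℕ (y * F)) + v ·ℕ (x * (w * F))   ≈⟨ +-cong (*-congˡ (×-assoc-* u y F)) (×-assoc-* v x (w * F)) ⟨
    w * ((u ·ℕ y) * F) + (v ·ℕ x) * (w * F)   ≈⟨ +-congˡ (x*[w*F]≈w*[x*F] (v ·ℕ x)) ⟩
    w * ((u ·ℕ y) * F) + w * ((v ·ℕ x) * F)   ≈⟨ distribˡ w _ _ ⟨
    w * ((u ·ℕ y) * F + (v ·ℕ x) * F)         ≈⟨ *-congˡ (+-comm _ _) ⟩
    w * ((v ·ℕ x) * F + (u ·ℕ y) * F)         ≈⟨ *-congˡ (distribʳ F _ _) ⟨
    w * ((v ·ℕ x + u ·ℕ y) * F)               ∎
    where
    x*[w*F]≈w*[x*F] : ∀ x → x * (w * F) ≈ w * (x * F)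
    x*[w*F]≈w*[x*F] x = ≈-trans (≈-sym (*-assoc x w F)) (≈-trans (*-congʳ (*-comm x w)) (*-assoc w x F))

  funSum : ∀ {k n} → ((Fin k → Fin n) → Carrier) → Carrier
  funSum {zero}      F = F (λ ())
  funSum {suc k} {n} F = ∑[ x < n ] funSum (λ g → F (x ∷ᶠ g))

  Respects≗ : ∀ {k n} → ((Fin k → Fin n) → Carrier) → Set ℓ
  Respects≗ F = ∀ {f g} → f ≗ g → F f ≈ F g

  funSum-cong : ∀ {k n} {F G : (Fin k → Fin n) → Carrier} → (∀ f → F f ≈ G f) → funSum F ≈ funSum G
  funSum-cong {zero}  F≈G = F≈G _
  funSum-cong {suc k} F≈G = sum-cong-≋ (λ x → funSum-cong {k} (λ g → F≈G (x ∷ᶠ g)))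

  funSum-zero : ∀ {k n} (F : (Fin k → Fin n) → Carrier) → (∀ f → F f ≈ 0#) → funSum F ≈ 0#
  funSum-zero {zero}  F F≈0 = F≈0 _
  funSum-zero {suc k} F F≈0 = sum-zero +-commutativeMonoid _ (λ x → funSum-zero {k} _ (λ g → F≈0 (x ∷ᶠ g)))

  *-distribˡ-funSum : ∀ {k n} z (F : (Fin k → Fin n) → Carrier) → z * funSum F ≈ funSum (λ f → z * F f)
  *-distribˡ-funSum {zero}  z F = ≈-refl
  *-distribˡ-funSum {suc k} {n} z F =
    ≈-trans (*-distribˡ-sum {n} z _) (sum-cong-≋ (λ x → *-distribˡ-funSum z (λ g → F (x ∷ᶠ g))))

  funSum-when : ∀ {k n} {P : Set} (P? : Dec P) (F : (Fin k → Fin n) → Carrier) →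
                funSum (λ f → when P? (F f)) ≈ when P? (funSum F)
  funSum-when (yes _) F = ≈-refl
  funSum-when {k} (no _) F = funSum-zero {k} (λ _ → 0#) (λ _ → ≈-refl)

  funSum-∑-comm : ∀ {k n m} (F : Fin m → (Fin k → Fin n) → Carrier) →
                  funSum (λ f → ∑[ i < m ] F i f) ≈ ∑[ i < m ] funSum (F i)
  funSum-∑-comm {zero}  F = ≈-refl
  funSum-∑-comm {suc k} {n} {m} F =
    ≈-trans (sum-cong-≋ (λ x → funSum-∑-comm {k} (λ i g → F i (x ∷ᶠ g)))) (∑-comm {n} {m} _)

  funSum-single : ∀ {k n} (F : (Fin k → Fin n) → Carrier) (g : Fin k → Fin n) → Respects≗ F →
                  (∀ f → ¬ f ≗ g → F f ≈ 0#) → funSum F ≈ F g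
  funSum-single {zero}  F g F-resp F≈0 = F-resp (λ ())
  funSum-single {suc k} {n} F g F-resp F≈0 = begin
    ∑[ x < n ] funSum (λ h → F (x ∷ᶠ h))
      ≈⟨ sum-single +-commutativeMonoid _ (g Fin.zero) (λ x x≢g₀ →
           funSum-zero {k} _ (λ h → F≈0 _ (λ eq → x≢g₀ (eq Fin.zero)))) ⟩
    funSum (λ h → F (g Fin.zero ∷ᶠ h))
      ≈⟨ funSum-single _ (tail g) (λ eq → F-resp (λ { Fin.zero → refl ; (Fin.suc i) → eq i }))
           (λ h h≢ → F≈0 _ (λ eq → h≢ (eq ∘ Fin.suc))) ⟩
    F (g Fin.zero ∷ᶠ tail g)
      ≈⟨ F-resp (λ { Fin.zero → refl ; (Fin.suc i) → refl }) ⟩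
    F g ∎

  funSum-redirect : ∀ {k n} (F : (Fin k → Fin n) → Carrier) → Respects≗ F → ∀ x d d′ →
                    funSum (λ f → when (f x Fin.≟ d) (F f)) ≈
                    funSum (λ g → when (g x Fin.≟ d′) (F (updateAt g x (const d))))
  funSum-redirect {suc k} {n} F F-resp Fin.zero d d′ = begin
    ∑[ y < n ] funSum (λ g → when (y Fin.≟ d) (F (y ∷ᶠ g)))
      ≈⟨ sum-cong-≋ (λ y → funSum-when {k} (y Fin.≟ d) _) ⟩
    ∑[ y < n ] when (y Fin.≟ d) (funSum (λ g → F (y ∷ᶠ g)))
      ≈⟨ sum-when-≟ _ d ⟩
    funSum (λ g → F (d ∷ᶠ g))
      ≈⟨ funSum-cong {k} (λ g → F-resp (λ { Fin.zero → refl ; (Fin.suc i) → refl })) ⟩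
    funSum (λ g → F (updateAt (d′ ∷ᶠ g) Fin.zero (const d)))
      ≈⟨ sum-when-≟ _ d′ ⟨
    ∑[ y < n ] when (y Fin.≟ d′) (funSum (λ g → F (updateAt (y ∷ᶠ g) Fin.zero (const d))))
      ≈⟨ sum-cong-≋ (λ y → funSum-when {k} (y Fin.≟ d′) _) ⟨
    ∑[ y < n ] funSum (λ g → when (y Fin.≟ d′) (F (updateAt (y ∷ᶠ g) Fin.zero (const d)))) ∎
  funSum-redirect {suc k} F F-resp (Fin.suc x) d d′ = sum-cong-≋ λ y → ≈-trans
    (funSum-redirect (λ g → F (y ∷ᶠ g)) (λ eq → F-resp (λ { Fin.zero → refl ; (Fin.suc i) → eq i })) x d d′)
    (funSum-cong {k} (λ g → when-congʳ (g x Fin.≟ d′) (F-resp (λ { Fin.zero → refl ; (Fin.suc i) → refl }))))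

  listSum-concatMap : ∀ {A B : Set} (F : B → Carrier) (h : A → List B) xs →
                      ∑ R (map F (concatMap h xs)) ≈ ∑ R (map (λ x → ∑ R (map F (h x))) xs)
  listSum-concatMap F h []       = ≈-refl
  listSum-concatMap F h (x ∷ xs) = begin
    ∑ R (map F (h x ++ concatMap h xs))              ≡⟨ cong (∑ R) (List.map-++ F (h x) _) ⟩
    ∑ R (map F (h x) ++ map F (concatMap h xs))      ≈⟨ foldr-++ +-commutativeMonoid (map F (h x)) _ ⟩
    ∑ R (map F (h x)) + ∑ R (map F (concatMap h xs)) ≈⟨ +-congˡ (listSum-concatMap F h xs) ⟩
    ∑ R (map (λ y → ∑ R (map F (h y))) (x ∷ xs))     ∎

  listSum-filter : ∀ {A : Set} {P : A → Set} (P? : ∀ x → Dec (P x)) (w : A → Carrier) xs →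
                   ∑ R (map w (filter P? xs)) ≈ ∑ R (map (λ x → when (P? x) (w x)) xs)
  listSum-filter P? w []       = ≈-refl
  listSum-filter P? w (x ∷ xs) with P? x
  ... | yes _ = +-congˡ (listSum-filter P? w xs)
  ... | no  _ = ≈-trans (listSum-filter P? w xs) (≈-sym (+-identityˡ _))

  listSum-tabulate : ∀ {A : Set} {n} (G : A → Carrier) (h : Fin n → A) → ∑ R (map G (tabulate h)) ≡ sum (G ∘ h)
  listSum-tabulate {n = zero}  G h = refl
  listSum-tabulate {n = suc n} G h = cong (G (h Fin.zero) +_) (listSum-tabulate G (h ∘ Fin.suc))

  listSum-allFuns : ∀ k n (F : (Fin k → Fin n) → Carrier) → ∑ R (map F (allFuns k n)) ≈ funSum F
  listSum-allFuns zero    n F = +-identityʳ _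
  listSum-allFuns (suc k) n F = begin
    ∑ R (map F (concatMap (λ x → map (x ∷ᶠ_) (allFuns k n)) (allFin n)))
      ≈⟨ listSum-concatMap F _ (allFin n) ⟩
    ∑ R (map (λ x → ∑ R (map F (map (x ∷ᶠ_) (allFuns k n)))) (allFin n))
      ≡⟨ listSum-tabulate {n = n} _ (λ x → x) ⟩
    ∑[ x < n ] ∑ R (map F (map (x ∷ᶠ_) (allFuns k n)))
      ≈⟨ sum-cong-≋ (λ x → ≈-trans (reflexive (cong (∑ R) (sym (List.map-∘ (allFuns k n)))))
                                   (listSum-allFuns k n (λ g → F (x ∷ᶠ g)))) ⟩
    funSum F ∎

  when-respects : ∀ {k n} {P : (Fin k → Fin n) → Set} (P? : ∀ f → Dec (P f)) →
                  (∀ {f g} → f ≗ g → P f → P g) → (W : (Fin k → Fin n) → Carrier) → Respects≗ W →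
                  Respects≗ (λ f → when (P? f) (W f))
  when-respects P? P-resp W W-resp {f} {g} f≗g =
    when-cong (P? f) (P? g) (mk⇔ (P-resp f≗g) (P-resp (sym ∘ f≗g))) (λ _ → W-resp f≗g)

  open import Algebra.Properties.CommutativeMonoid.Sum *-commutativeMonoid
    using () renaming (sum to prod; sum-cong-≋ to prod-cong-≋)

  -- Rooted forests with a prescribed set of roots

  module Forests (a b : Carrier) (N : ℕ) where

    RootsFixed : (Fin N → Bool) → (Fin N → Fin N) → Set
    RootsFixed S f = ∀ s → S s ≡ true → f s ≡ s

    IsForest : (Fin N → Bool) → (Fin N → Fin N) → Set
    IsForest S f = RootsFixed S f × (∀ v → S (iter f N v) ≡ true)

    isForest? : ∀ S f → Dec (IsForest S f)
    isForest? S f = Fin.all? (λ s → (S s Bool.≟ true) →-dec (f s Fin.≟ s))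
                    ×-dec Fin.all? (λ v → S (iter f N v) Bool.≟ true)

    InTreeOf : (Fin N → Bool) → (m d : Fin N) → (Fin N → Fin N) → Set
    InTreeOf S m d f = IsForest S f × iter f N m ≡ d

    inTreeOf? : ∀ S m d f → Dec (InTreeOf S m d f)
    inTreeOf? S m d f = isForest? S f ×-dec (iter f N m Fin.≟ d)

    IsTopOfPath : (Fin N → Bool) → (m d x : Fin N) → (Fin N → Fin N) → Set
    IsTopOfPath S m d x f = IsForest S f × S x ≡ false × f x ≡ d × Descendant N f x m

    isTopOfPath? : ∀ S m d x f → Dec (IsTopOfPath S m d x f)
    isTopOfPath? S m d x f =
      isForest? S f ×-dec (S x Bool.≟ false) ×-dec (f x Fin.≟ d) ×-dec descendant? N f x m

    propernessWeight : {P : Set} → Dec P → Carrier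
    propernessWeight (yes _) = b
    propernessWeight (no _)  = a

    -- Vertex 0 is proper in every forest: weighting it by 1 accounts for the exponent prop − 1.
    nonRootWeight : (Fin N → Fin N) → Fin N → Carrier
    nonRootWeight f Fin.zero      = 1#
    nonRootWeight f v@(Fin.suc _) = propernessWeight (isProper? N f v)

    vertexWeight : (Fin N → Bool) → (Fin N → Fin N) → Fin N → Carrier
    vertexWeight S f v = if S v then 1# else nonRootWeight f v

    weight : (Fin N → Bool) → (Fin N → Fin N) → Carrier
    weight S f = prod (vertexWeight S f)

    forestSum : (Fin N → Bool) → Carrier
    forestSum S = funSum (λ f → when (isForest? S f) (weight S f))

    forestSumAt : (Fin N → Bool) → (m d : Fin N) → Carrier
    forestSumAt S m d = funSum (λ f → when (inTreeOf? S m d f) (weight S f))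

    topOfPathSum : (Fin N → Bool) → (m d x : Fin N) → Carrier
    topOfPathSum S m d x = funSum (λ f → when (isTopOfPath? S m d x f) (weight S f))

    module _ {f g : Fin N → Fin N} (f≗g : f ≗ g) where

      forest-≗ : ∀ {S} → IsForest S f → IsForest S g
      forest-≗ {S} (fixed , reach) =
        (λ s Ss → trans (sym (f≗g s)) (fixed s Ss)) , (λ v → trans (cong S (sym (iter-cong f≗g N v))) (reach v))

      descendant-≗ : ∀ {v w} → Descendant N f v w → Descendant N g v w
      descendant-≗ (k , fᵏw≡v) = k , trans (sym (iter-cong f≗g (toℕ k) _)) fᵏw≡v

      topOfPath-≗ : ∀ {S m d x} → IsTopOfPath S m d x f → IsTopOfPath S m d x g
      topOfPath-≗ (forest , Sx , fx≡d , desc) =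
        forest-≗ forest , Sx , trans (sym (f≗g _)) fx≡d , descendant-≗ desc

    proper-cong : ∀ {f g v} → (∀ w → Descendant N f v w ⇔ Descendant N g v w) →
                  IsProper N f v ⇔ IsProper N g v
    proper-cong desc⇔ = mk⇔ (λ proper w → proper w ∘ Equivalence.from (desc⇔ w))
                            (λ proper w → proper w ∘ Equivalence.to (desc⇔ w))

    propernessWeight-cong : ∀ {P Q : Set} (P? : Dec P) (Q? : Dec Q) → P ⇔ Q →
                            propernessWeight P? ≈ propernessWeight Q?
    propernessWeight-cong (yes _) (yes _) _   = ≈-refl
    propernessWeight-cong (yes p) (no ¬q) P⇔Q = contradiction (Equivalence.to P⇔Q p) ¬q
    propernessWeight-cong (no ¬p) (yes q) P⇔Q = contradiction (Equivalence.from P⇔Q q) ¬p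
    propernessWeight-cong (no _)  (no _)  _   = ≈-refl

    nonRootWeight-cong : ∀ {f g} v → (∀ w → Descendant N f v w ⇔ Descendant N g v w) →
                         nonRootWeight f v ≈ nonRootWeight g v
    nonRootWeight-cong Fin.zero      desc⇔ = ≈-refl
    nonRootWeight-cong (Fin.suc _)   desc⇔ = propernessWeight-cong _ _ (proper-cong desc⇔)

    weight-≗ : ∀ S {f g} → f ≗ g → weight S f ≈ weight S g
    weight-≗ S {f} {g} f≗g = prod-cong-≋ vertex
      where
      vertex : ∀ v → vertexWeight S f v ≈ vertexWeight S g v
      vertex v with S v
      ... | true  = ≈-refl
      ... | false = nonRootWeight-cong v (λ w → mk⇔ (descendant-≗ f≗g) (descendant-≗ (sym ∘ f≗g)))

    descendant : ∀ {f : Fin N → Fin N} {v w j} → j ℕ.≤ N → iter f j w ≡ v → Descendant N f v w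
    descendant {f} {w = w} j≤N fʲw≡v =
      fromℕ< (s≤s j≤N) , trans (cong (λ i → iter f i w) (Fin.toℕ-fromℕ< (s≤s j≤N))) fʲw≡v

    iter-N-via-ancestor : ∀ {f : Fin N → Fin N} {m x d} → f d ≡ d → f x ≡ d → Descendant N f x m →
                          iter f N m ≡ d
    iter-N-via-ancestor {f} fd≡d fx≡d (k , fᵏm≡x) =
      fixed-point-reached-within-N f {suc (toℕ k)} fd≡d (trans (cong f fᵏm≡x) fx≡d)

    weight-insert : ∀ S f {x} → S x ≡ false → weight S f ≈ nonRootWeight f x * weight (insert S x) f
    weight-insert S f {x} Sx≡false = begin
      weight S f
        ≈⟨ *-identityʳ _ ⟨
      weight S f * 1#
        ≡⟨ cong (λ β → weight S f * (if β then 1# else nonRootWeight f x)) (insert-self S x) ⟨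
      weight S f * vertexWeight (insert S x) f x
        ≈⟨ sum-exchange *-commutativeMonoid _ _ x agree ⟩
      vertexWeight S f x * weight (insert S x) f
        ≡⟨ cong (λ β → (if β then 1# else nonRootWeight f x) * weight (insert S x) f) Sx≡false ⟩
      nonRootWeight f x * weight (insert S x) f ∎
      where
      agree : ∀ i → i ≢ x → vertexWeight S f i ≈ vertexWeight (insert S x) f i
      agree i i≢x = reflexive (cong (λ β → if β then 1# else nonRootWeight f i) (sym (insert-≢ S i≢x)))

    -- f hangs the new root x of S′ below the root d; conversely g is f with the edge x → d cut.
    module Cut {S : Fin N → Bool} {x d : Fin N} (Sx≡false : S x ≡ false) (Sd≡true : S d ≡ true)
               (g : Fin N → Fin N) (gx≡x : g x ≡ x) where

      f : Fin N → Fin N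
      f = updateAt g x (const d)

      S′ : Fin N → Bool
      S′ = insert S x

      f≡g : ∀ i → i ≢ x → f i ≡ g i
      f≡g i i≢x = updateAt-minimal i x g i≢x

      fx≡d : f x ≡ d
      fx≡d = updateAt-updates x g

      S′x≡true : S′ x ≡ true
      S′x≡true = insert-self S x

      S′≡S : ∀ i → i ≢ x → S′ i ≡ S i
      S′≡S i i≢x = insert-≢ S i≢x

      root≢x : ∀ {i} → S i ≡ true → i ≢ x
      root≢x Si≡true = member≢nonmember Si≡true Sx≡false

      S⊆S′ : ∀ {i} → S i ≡ true → S′ i ≡ true
      S⊆S′ {i} Si≡true = trans (S′≡S i (root≢x Si≡true)) Si≡true

      paths : f d ≡ d → ∀ k v → iter f k v ≡ iter g k v ⊎ (iter f k v ≡ d × iter g k v ≡ x)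
      paths = iter-redirect f f≡g fx≡d gx≡x

      forest-cut : IsForest S f → IsForest S′ g
      forest-cut (fixed , reach) = fixed′ , reach′
        where
        fixed′ : RootsFixed S′ g
        fixed′ s S′s≡true with s Fin.≟ x
        ... | yes refl = gx≡x
        ... | no  s≢x  = trans (sym (f≡g s s≢x)) (fixed s (trans (sym (S′≡S s s≢x)) S′s≡true))
        reach′ : ∀ v → S′ (iter g N v) ≡ true
        reach′ v with paths (fixed d Sd≡true) N v
        ... | inj₁ fᴺv≡gᴺv      = subst (λ u → S′ u ≡ true) fᴺv≡gᴺv (S⊆S′ (reach v))
        ... | inj₂ (_ , gᴺv≡x) = trans (cong S′ gᴺv≡x) S′x≡true

      forest-uncut : IsForest S′ g → IsForest S f
      forest-uncut (fixed′ , reach′) = fixed , reach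
        where
        fixed : RootsFixed S f
        fixed s Ss≡true = trans (f≡g s (root≢x Ss≡true)) (fixed′ s (S⊆S′ Ss≡true))
        fd≡d : f d ≡ d
        fd≡d = fixed d Sd≡true
        reach : ∀ v → S (iter f N v) ≡ true
        reach v with paths fd≡d N v
        ... | inj₂ (fᴺv≡d , _) = trans (cong S fᴺv≡d) Sd≡true
        ... | inj₁ fᴺv≡gᴺv with iter g N v Fin.≟ x
        ...   | no gᴺv≢x = trans (cong S fᴺv≡gᴺv) (trans (sym (S′≡S _ gᴺv≢x)) (reach′ v))
        ...   | yes gᴺv≡x = trans (cong S fᴺv≡d) Sd≡true
          where
          fᴺv≡d : iter f N v ≡ d
          fᴺv≡d = fixed-point-reached-within-N f {suc N} fd≡d (trans (cong f (trans fᴺv≡gᴺv gᴺv≡x)) fx≡d)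

      topOfPath⇔inTreeOf : ∀ {m} → IsTopOfPath S m d x f ⇔ InTreeOf S′ m x g
      topOfPath⇔inTreeOf {m} = mk⇔ to from
        where
        to : IsTopOfPath S m d x f → InTreeOf S′ m x g
        to (forest , _ , _ , k , fᵏm≡x) = forest-cut forest , iter-stays g (ℕ.≤-pred (Fin.toℕ<n k)) gᵏm≡x gx≡x
          where
          gᵏm≡x : iter g (toℕ k) m ≡ x
          gᵏm≡x with paths (proj₁ forest d Sd≡true) (toℕ k) m
          ... | inj₁ fᵏm≡gᵏm     = trans (sym fᵏm≡gᵏm) fᵏm≡x
          ... | inj₂ (_ , gᵏm≡x) = gᵏm≡x
        from : InTreeOf S′ m x g → IsTopOfPath S m d x f
        from (forest′ , gᴺm≡x) = forest-uncut forest′ , Sx≡false , fx≡d , x-above-m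
          where
          x-above-m : Descendant N f x m
          x-above-m with iter-agree-until-hit f f≡g N m
          ... | inj₁ fᴺm≡gᴺm           = descendant ℕ.≤-refl (trans fᴺm≡gᴺm gᴺm≡x)
          ... | inj₂ (j , j≤N , fʲm≡x) = descendant j≤N fʲm≡x

      weight-cut : IsForest S f → weight S f ≈ nonRootWeight f x * weight S′ g
      weight-cut (fixed , _) = ≈-trans (weight-insert S f Sx≡false) (*-congˡ (prod-cong-≋ agree))
        where
        fd≡d : f d ≡ d
        fd≡d = fixed d Sd≡true
        agree : ∀ i → vertexWeight S′ f i ≈ vertexWeight S′ g i
        agree i with S′ i in S′i≡b
        ... | true  = ≈-refl
        ... | false = nonRootWeight-cong i (λ w → mk⇔ (f→g w) (g→f w))
          where
          i≢d : i ≢ d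
          i≢d = member≢nonmember (S⊆S′ Sd≡true) S′i≡b ∘ sym
          i≢x : i ≢ x
          i≢x = member≢nonmember S′x≡true S′i≡b ∘ sym
          f→g : ∀ w → Descendant N f i w → Descendant N g i w
          f→g w (k , fᵏw≡i) with paths fd≡d (toℕ k) w
          ... | inj₁ fᵏw≡gᵏw     = k , trans (sym fᵏw≡gᵏw) fᵏw≡i
          ... | inj₂ (fᵏw≡d , _) = contradiction (trans (sym fᵏw≡i) fᵏw≡d) i≢d
          g→f : ∀ w → Descendant N g i w → Descendant N f i w
          g→f w (k , gᵏw≡i) with paths fd≡d (toℕ k) w
          ... | inj₁ fᵏw≡gᵏw     = k , trans fᵏw≡gᵏw gᵏw≡i
          ... | inj₂ (_ , gᵏw≡x) = contradiction (trans (sym gᵏw≡i) gᵏw≡x) i≢x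

    topOfPathSum-cut : ∀ {S m d x} c → S x ≡ false → S d ≡ true →
                       (∀ f → IsTopOfPath S m d x f → nonRootWeight f x ≈ c) →
                       topOfPathSum S m d x ≈ c * forestSumAt (insert S x) m x
    topOfPathSum-cut {S} {m} {d} {x} c Sx≡false Sd≡true weight-x≈c = begin
      funSum (λ f → when (isTopOfPath? S m d x f) (weight S f))
        ≈⟨ funSum-cong (λ f →
             when-implied (isTopOfPath? S m d x f) (f x Fin.≟ d) (proj₁ ∘ proj₂ ∘ proj₂)) ⟨
      funSum (λ f → when (f x Fin.≟ d) (when (isTopOfPath? S m d x f) (weight S f)))
        ≈⟨ funSum-redirect _ (when-respects (isTopOfPath? S m d x) (λ f≗g → topOfPath-≗ f≗g)
                                            (weight S) (weight-≗ S)) x d x ⟩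
      funSum (λ g → when (g x Fin.≟ x) (when (isTopOfPath? S m d x (cut g)) (weight S (cut g))))
        ≈⟨ funSum-cong cut-summand ⟩
      funSum (λ g → c * when (inTreeOf? S′ m x g) (weight S′ g))
        ≈⟨ *-distribˡ-funSum c (λ g → when (inTreeOf? S′ m x g) (weight S′ g)) ⟨
      c * forestSumAt S′ m x ∎
      where
      S′ : Fin N → Bool
      S′ = insert S x
      cut : (Fin N → Fin N) → Fin N → Fin N
      cut g = updateAt g x (const d)
      cut-summand : ∀ g → when (g x Fin.≟ x) (when (isTopOfPath? S m d x (cut g)) (weight S (cut g))) ≈
                          c * when (inTreeOf? S′ m x g) (weight S′ g)
      cut-summand g with g x Fin.≟ x
      ... | yes gx≡x = ≈-trans
            (when-cong (isTopOfPath? S m d x (cut g)) (inTreeOf? S′ m x g) topOfPath⇔inTreeOf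
                       (λ top → ≈-trans (weight-cut (proj₁ top)) (*-congʳ (weight-x≈c _ top))))
            (≈-sym (*-distribˡ-when (inTreeOf? S′ m x g) c _))
        where open Cut {S} Sx≡false Sd≡true g gx≡x using (topOfPath⇔inTreeOf; weight-cut)
      ... | no gx≢x = ≈-sym (≈-trans (*-congˡ (when-no (inTreeOf? S′ m x g) x-not-fixed)) (zeroʳ c))
        where
        x-not-fixed : ¬ InTreeOf S′ m x g
        x-not-fixed ((fixed′ , _) , _) = gx≢x (fixed′ x (insert-self S x))

    forestSum≈∑forestSumAt : ∀ S m → forestSum S ≈ ∑[ d < N ] forestSumAt S m d
    forestSum≈∑forestSumAt S m =
      ≈-trans (funSum-cong split) (funSum-∑-comm (λ d f → when (inTreeOf? S m d f) (weight S f)))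
      where
      split : ∀ f → when (isForest? S f) (weight S f) ≈ ∑[ d < N ] when (inTreeOf? S m d f) (weight S f)
      split f = when-elim (isForest? S f)
        (λ forest → ≈-sym (≈-trans
          (sum-single +-commutativeMonoid _ (iter f N m)
            (λ d d≢fᴺm → when-no (inTreeOf? S m d f) (d≢fᴺm ∘ sym ∘ proj₂)))
          (when-yes (inTreeOf? S m (iter f N m) f) (forest , refl))))
        (λ ¬forest → ≈-sym (sum-zero +-commutativeMonoid _ (λ d → when-no (inTreeOf? S m d f) (¬forest ∘ proj₁))))

    forestSum-uniform : ∀ S m X → (∀ d → S d ≡ true → forestSumAt S m d ≈ X) → forestSum S ≈ count S ·ℕ X
    forestSum-uniform S m X at-root =
      ≈-trans (forestSum≈∑forestSumAt S m) (sum-count S _ at-root at-non-root)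
      where
      at-non-root : ∀ d → S d ≡ false → forestSumAt S m d ≈ 0#
      at-non-root d Sd≡false = funSum-zero _ (λ f → when-no (inTreeOf? S m d f)
        (λ ((_ , reach) , fᴺm≡d) → member≢nonmember (reach m) Sd≡false fᴺm≡d))

    forestSum-all-roots : ∀ S → (∀ v → S v ≡ true) → forestSum S ≈ 1#
    forestSum-all-roots S all-roots = begin
      forestSum S
        ≈⟨ funSum-single _ (λ v → v)
             (when-respects (isForest? S) (λ f≗g → forest-≗ f≗g) (weight S) (weight-≗ S))
             (λ f f≢id → when-no (isForest? S f) (λ (fixed , _) → f≢id (λ v → fixed v (all-roots v)))) ⟩
      when (isForest? S (λ v → v)) (weight S (λ v → v))
        ≈⟨ when-yes (isForest? S (λ v → v)) ((λ s _ → refl) , (λ v → all-roots _)) ⟩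
      weight S (λ v → v)
        ≈⟨ sum-zero *-commutativeMonoid _
             (λ v → reflexive (cong (λ β → if β then 1# else nonRootWeight (λ v → v) v) (all-roots v))) ⟩
      1# ∎

    top-exists : ∀ {S m d f} → S m ≡ false → InTreeOf S m d f → ∃[ x ] IsTopOfPath S m d x f
    top-exists {S} {m} {d} {f} Sm≡false (forest@(fixed , reach) , fᴺm≡d)
      with k , k<N , Sfᵏm≡false , Sfᵏ⁺¹m≡true ← rising-edge (λ k → S (iter f k m)) Sm≡false N (reach m)
      = iter f k m , forest , Sfᵏm≡false , trans (sym fᴺm≡fᵏ⁺¹m) fᴺm≡d , descendant (ℕ.<⇒≤ k<N) refl
      where
      fᴺm≡fᵏ⁺¹m : iter f N m ≡ iter f (suc k) m
      fᴺm≡fᵏ⁺¹m = iter-stays f k<N refl (fixed _ Sfᵏ⁺¹m≡true)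

    top-unique : ∀ {S m d x y f} → S d ≡ true → IsTopOfPath S m d x f → IsTopOfPath S m d y f → x ≡ y
    top-unique {S} {m} {d} {x} {y} {f} Sd≡true
               ((fixed , _) , Sx≡false , fx≡d , i , fⁱm≡x) (_ , Sy≡false , fy≡d , j , fʲm≡y)
      with ℕ.<-cmp (toℕ i) (toℕ j)
    ... | tri< i<j _ _ =
      contradiction (trans (sym (iter-stays f i<j (trans (cong f fⁱm≡x) fx≡d) (fixed d Sd≡true))) fʲm≡y)
                    (member≢nonmember Sd≡true Sy≡false)
    ... | tri≈ _ i≡j _ = trans (sym fⁱm≡x) (trans (cong (λ k → iter f k m) i≡j) fʲm≡y)
    ... | tri> _ _ j<i =
      contradiction (trans (sym (iter-stays f j<i (trans (cong f fʲm≡y) fy≡d) (fixed d Sd≡true))) fⁱm≡x)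
                    (member≢nonmember Sd≡true Sx≡false)

    forestSumAt≈∑topOfPathSum : ∀ S m d → S m ≡ false → S d ≡ true →
                                forestSumAt S m d ≈ ∑[ x < N ] topOfPathSum S m d x
    forestSumAt≈∑topOfPathSum S m d Sm≡false Sd≡true =
      ≈-trans (funSum-cong split) (funSum-∑-comm (λ x f → when (isTopOfPath? S m d x f) (weight S f)))
      where
      top⇒inTree : ∀ {x f} → IsTopOfPath S m d x f → InTreeOf S m d f
      top⇒inTree (forest , _ , fx≡d , x-above-m) =
        forest , iter-N-via-ancestor (proj₁ forest d Sd≡true) fx≡d x-above-m
      split : ∀ f → when (inTreeOf? S m d f) (weight S f) ≈ ∑[ x < N ] when (isTopOfPath? S m d x f) (weight S f)
      split f = when-elim (inTreeOf? S m d f)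
        (λ inTree → let x , top = top-exists Sm≡false inTree in ≈-sym (≈-trans
          (sum-single +-commutativeMonoid _ x
            (λ y y≢x → when-no (isTopOfPath? S m d y f) (λ top′ → y≢x (top-unique Sd≡true top′ top))))
          (when-yes (isTopOfPath? S m d x f) top)))
        (λ ¬inTree → ≈-sym (sum-zero +-commutativeMonoid _
          (λ x → when-no (isTopOfPath? S m d x f) (¬inTree ∘ top⇒inTree))))

    properWeight : Fin N → Carrier
    properWeight Fin.zero    = 1#
    properWeight (Fin.suc _) = b

    nonRootWeight-proper : ∀ {f} v → IsProper N f v → nonRootWeight f v ≈ properWeight v
    nonRootWeight-proper     Fin.zero      _      = ≈-refl
    nonRootWeight-proper {f} v@(Fin.suc _) proper with isProper? N f v
    ... | yes _      = ≈-refl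
    ... | no ¬proper = contradiction proper ¬proper

    least-proper : ∀ {S m f} → IsLeastOutside S m → RootsFixed S f → IsProper N f m
    least-proper {S} {m} {f} (_ , least) fixed w (k , fᵏw≡m) w≢m =
      ℕ.≤∧≢⇒< (least w Sw≡false) (w≢m ∘ sym ∘ Fin.toℕ-injective)
      where
      Sw≡false : S w ≡ false
      Sw≡false with S w in Sw≡b
      ... | false = refl
      ... | true  = contradiction (trans (sym (iter-fixed f (fixed w Sw≡b) (toℕ k))) fᵏw≡m) w≢m

    nonRootWeight-above-least : ∀ {S m x f} → IsLeastOutside S m → S x ≡ false → x ≢ m →
                                Descendant N f x m → nonRootWeight f x ≈ a
    nonRootWeight-above-least {x = Fin.zero} (_ , least) Sx≡false x≢m _ =
      contradiction (sym (Fin.toℕ-injective (ℕ.n≤0⇒n≡0 (least Fin.zero Sx≡false)))) x≢m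
    nonRootWeight-above-least {m = m} {x = x@(Fin.suc _)} {f} (_ , least) Sx≡false x≢m m-below-x
      with isProper? N f x
    ... | yes proper = contradiction (proper m m-below-x (x≢m ∘ sym)) (ℕ.≤⇒≯ (least x Sx≡false))
    ... | no _       = ≈-refl

    properWeight-next-least : ∀ {S m m′} → IsLeastOutside S m → IsLeastOutside (insert S m) m′ →
                              properWeight m′ ≡ b
    properWeight-next-least {m′ = Fin.suc _} _ _ = refl
    properWeight-next-least {S} {m} {Fin.zero} (_ , least) (S′0≡false , _) with Fin.zero Fin.≟ m
    ... | yes refl = contradiction (trans (sym (insert-self S Fin.zero)) S′0≡false) λ ()
    ... | no 0≢m   = contradiction (sym (Fin.toℕ-injective (ℕ.n≤0⇒n≡0 (least Fin.zero S0≡false)))) 0≢m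
      where
      S0≡false : S Fin.zero ≡ false
      S0≡false = trans (sym (insert-≢ S 0≢m)) S′0≡false

    forestSumAt-root : ∀ S m → S m ≡ true → forestSumAt S m m ≈ forestSum S
    forestSumAt-root S m Sm≡true = funSum-cong (λ f → when-cong (inTreeOf? S m m f) (isForest? S f)
      (mk⇔ proj₁ (λ forest → forest , iter-fixed f (proj₁ forest m Sm≡true) N)) (λ _ → ≈-refl))

    topOfPathSum-root : ∀ S m d x → S x ≡ true → topOfPathSum S m d x ≈ 0#
    topOfPathSum-root S m d x Sx≡true = funSum-zero _ (λ f → when-no (isTopOfPath? S m d x f)
      (λ (_ , Sx≡false , _) → contradiction (trans (sym Sx≡true) Sx≡false) λ ()))

    topOfPathSum-least : ∀ {S m d} → IsLeastOutside S m → S d ≡ true →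
                         topOfPathSum S m d m ≈ properWeight m * forestSum (insert S m)
    topOfPathSum-least {S} {m} least@(Sm≡false , _) Sd≡true = ≈-trans
      (topOfPathSum-cut (properWeight m) Sm≡false Sd≡true
        (λ f top → nonRootWeight-proper m (least-proper least (proj₁ (proj₁ top)))))
      (*-congˡ (forestSumAt-root (insert S m) m (insert-self S m)))

    topOfPathSum-above-least : ∀ {S m d x} → IsLeastOutside S m → S x ≡ false → x ≢ m → S d ≡ true →
                               topOfPathSum S m d x ≈ a * forestSumAt (insert S x) m x
    topOfPathSum-above-least least Sx≡false x≢m Sd≡true = topOfPathSum-cut a Sx≡false Sd≡true
      (λ f (_ , _ , _ , m-below-x) → nonRootWeight-above-least least Sx≡false x≢m m-below-x)

    ∑-topOfPathSum-above-least : ∀ {S m d} y → (∀ x → S x ≡ false → x ≢ m → topOfPathSum S m d x ≈ y) →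
                                 ∑[ x < N ] when (¬? (x Fin.≟ m)) (topOfPathSum S m d x) ≈
                                 count (not ∘ insert S m) ·ℕ y
    ∑-topOfPathSum-above-least {S} {m} {d} y above = sum-count (not ∘ insert S m) _ outside inside
      where
      outside : ∀ x → not (insert S m x) ≡ true → when (¬? (x Fin.≟ m)) (topOfPathSum S m d x) ≈ y
      outside x x∉S′ with x Fin.≟ m
      ... | yes refl = contradiction (trans (sym (cong not (insert-self S x))) x∉S′) λ ()
      ... | no x≢m   = above x (trans (sym (insert-≢ S x≢m)) (Bool.not-injective x∉S′)) x≢m
      inside : ∀ x → not (insert S m x) ≡ false → when (¬? (x Fin.≟ m)) (topOfPathSum S m d x) ≈ 0#
      inside x x∈S′ with x Fin.≟ m
      ... | yes _  = ≈-refl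
      ... | no x≢m = topOfPathSum-root S m d x (trans (sym (insert-≢ S x≢m)) (Bool.not-injective x∈S′))

    forestSumAt-split : ∀ {S m d} → IsLeastOutside S m → S d ≡ true →
                        forestSumAt S m d ≈ properWeight m * forestSum (insert S m) +
                                            ∑[ x < N ] when (¬? (x Fin.≟ m)) (topOfPathSum S m d x)
    forestSumAt-split {S} {m} {d} least@(Sm≡false , _) Sd≡true = ≈-trans
      (forestSumAt≈∑topOfPathSum S m d Sm≡false Sd≡true)
      (≈-trans (sum-split-at _ m) (+-congʳ (topOfPathSum-least least Sd≡true)))

    forestProduct : ℕ → ℕ → Carrier
    forestProduct zero    t = 1#
    forestProduct (suc s) t = (suc s ·ℕ a + suc t ·ℕ b) * forestProduct s (suc t)

    forestSum-formula : ∀ s {S m} → IsLeastOutside S m → count (not ∘ S) ≡ suc s →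
                        forestSum S ≈ count S ·ℕ (properWeight m * forestProduct s (count S))
    forestSumAt-formula : ∀ s {S m d} → IsLeastOutside S m → count (not ∘ S) ≡ suc s → S d ≡ true →
                          forestSumAt S m d ≈ properWeight m * forestProduct s (count S)

    forestSum-formula s {S} {m} least #nonroots =
      forestSum-uniform S m _ (λ d Sd≡true → forestSumAt-formula s least #nonroots Sd≡true)

    forestSumAt-formula zero {S} {m} {d} least@(Sm≡false , _) #nonroots Sd≡true = begin
      forestSumAt S m d
        ≈⟨ forestSumAt-split least Sd≡true ⟩
      properWeight m * forestSum S′ + ∑[ x < N ] when (¬? (x Fin.≟ m)) (topOfPathSum S m d x)
        ≈⟨ +-cong (*-congˡ (forestSum-all-roots S′ all-roots)) (∑-topOfPathSum-above-least 0# no-other-nonroot) ⟩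
      properWeight m * 1# + count (not ∘ S′) ·ℕ 0#
        ≡⟨ cong (λ k → properWeight m * 1# + k ·ℕ 0#) #nonroots′ ⟩
      properWeight m * 1# + 0#
        ≈⟨ +-identityʳ _ ⟩
      properWeight m * forestProduct 0 (count S) ∎
      where
      S′ : Fin N → Bool
      S′ = insert S m
      #nonroots′ : count (not ∘ S′) ≡ 0
      #nonroots′ = ℕ.suc-injective (trans (sym (count-not-insert S Sm≡false)) #nonroots)
      all-roots : ∀ v → S′ v ≡ true
      all-roots v = Bool.not-injective (count≡0⇒false (not ∘ S′) #nonroots′ v)
      no-other-nonroot : ∀ x → S x ≡ false → x ≢ m → topOfPathSum S m d x ≈ 0#
      no-other-nonroot x Sx≡false x≢m =
        contradiction (trans (sym (all-roots x)) (trans (insert-≢ S x≢m) Sx≡false)) λ ()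
    forestSumAt-formula (suc s) {S} {m} {d} least@(Sm≡false , _) #nonroots Sd≡true = begin
      forestSumAt S m d
        ≈⟨ forestSumAt-split least Sd≡true ⟩
      properWeight m * forestSum S′ + ∑[ x < N ] when (¬? (x Fin.≟ m)) (topOfPathSum S m d x)
        ≈⟨ +-cong (*-congˡ (forestSum-formula s least′ #nonroots′)) (∑-topOfPathSum-above-least _ above-least) ⟩
      properWeight m * (count S′ ·ℕ (properWeight m′ * forestProduct s (count S′))) +
      count (not ∘ S′) ·ℕ (a * (properWeight m * F))
        ≡⟨ cong₂ (λ t u → properWeight m * (t ·ℕ (properWeight m′ * forestProduct s t)) +
                          u ·ℕ (a * (properWeight m * F)))
                 (count-insert S Sm≡false) #nonroots′ ⟩
      properWeight m * (suc (count S) ·ℕ (properWeight m′ * F)) + suc s ·ℕ (a * (properWeight m * F))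
        ≡⟨ cong (λ w → properWeight m * (suc (count S) ·ℕ (w * F)) + suc s ·ℕ (a * (properWeight m * F)))
                (properWeight-next-least least least′) ⟩
      properWeight m * (suc (count S) ·ℕ (b * F)) + suc s ·ℕ (a * (properWeight m * F))
        ≈⟨ collect-× (properWeight m) a b F (suc (count S)) (suc s) ⟩
      properWeight m * forestProduct (suc s) (count S) ∎
      where
      S′ : Fin N → Bool
      S′ = insert S m
      F : Carrier
      F = forestProduct s (suc (count S))
      #nonroots′ : count (not ∘ S′) ≡ suc s
      #nonroots′ = ℕ.suc-injective (trans (sym (count-not-insert S Sm≡false)) #nonroots)
      m′ : Fin N
      m′ = proj₁ (leastOutside S′ #nonroots′)
      least′ : IsLeastOutside S′ m′
      least′ = proj₂ (leastOutside S′ #nonroots′)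
      above-least : ∀ x → S x ≡ false → x ≢ m → topOfPathSum S m d x ≈ a * (properWeight m * F)
      above-least x Sx≡false x≢m = ≈-trans (topOfPathSum-above-least least Sx≡false x≢m Sd≡true)
        (*-congˡ (≈-trans (forestSumAt-formula s (leastOutside-insert least x≢m)
                                (ℕ.suc-injective (trans (sym (count-not-insert S Sx≡false)) #nonroots))
                                (insert-self S x))
                          (reflexive (cong (λ t → properWeight m * forestProduct s t) (count-insert S Sx≡false)))))

    forestProduct≈∏ : ∀ s t →
                      forestProduct s t ≈ ∏ R (map (λ j → suc j ·ℕ a + ((t ℕ.+ s) ∸ j) ·ℕ b) (upTo s))
    forestProduct≈∏ zero    t = ≈-refl
    forestProduct≈∏ (suc s) t = begin
      (suc s ·ℕ a + suc t ·ℕ b) * forestProduct s (suc t)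
        ≈⟨ *-congˡ (forestProduct≈∏ s (suc t)) ⟩
      (suc s ·ℕ a + suc t ·ℕ b) * ∏ R (map (factor (suc t ℕ.+ s)) (upTo s))
        ≡⟨ cong (λ u → (suc s ·ℕ a + u ·ℕ b) * ∏ R (map (factor (suc t ℕ.+ s)) (upTo s)))
                (ℕ.m+n∸n≡m (suc t) s) ⟨
      factor (suc t ℕ.+ s) s * ∏ R (map (factor (suc t ℕ.+ s)) (upTo s))
        ≈⟨ *-comm _ _ ⟩
      ∏ R (map (factor (suc t ℕ.+ s)) (upTo s)) * factor (suc t ℕ.+ s) s
        ≈⟨ *-congˡ (*-identityʳ _) ⟨
      ∏ R (map (factor (suc t ℕ.+ s)) (upTo s)) * ∏ R [ factor (suc t ℕ.+ s) s ]
        ≈⟨ foldr-++ *-commutativeMonoid (map (factor (suc t ℕ.+ s)) (upTo s)) _ ⟨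
      ∏ R (map (factor (suc t ℕ.+ s)) (upTo s) ++ [ factor (suc t ℕ.+ s) s ])
        ≡⟨ cong (∏ R) (List.map-++ (factor (suc t ℕ.+ s)) (upTo s) [ s ]) ⟨
      ∏ R (map (factor (suc t ℕ.+ s)) (upTo s ++ [ s ]))
        ≡⟨ cong₂ (λ u js → ∏ R (map (factor u) js)) (sym (ℕ.+-suc t s)) (List.upTo-∷ʳ s) ⟩
      ∏ R (map (factor (t ℕ.+ suc s)) (upTo (suc s))) ∎
      where
      factor : ℕ → ℕ → Carrier
      factor u j = suc j ·ℕ a + (u ∸ j) ·ℕ b

    prod-propernessWeight : ∀ {M} {P : Fin M → Set} (P? : ∀ v → Dec (P v)) →
                            prod (λ v → propernessWeight (P? v)) ≈
                            a ^ (M ∸ count (does ∘ P?)) * b ^ count (does ∘ P?)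
    prod-propernessWeight {zero}  P? = ≈-sym (*-identityˡ _)
    prod-propernessWeight {suc M} P?
      with P? Fin.zero | prod-propernessWeight (P? ∘ Fin.suc) | count-≤ (does ∘ P? ∘ Fin.suc)
    ... | yes _ | ih | _ = ≈-trans (*-congˡ ih) (≈-trans (≈-sym (*-assoc b _ _))
                             (≈-trans (*-congʳ (*-comm b _)) (*-assoc _ b _)))
    ... | no  _ | ih | c≤M = ≈-trans (*-congˡ ih) (≈-trans (≈-sym (*-assoc a _ _))
                               (*-congʳ (reflexive (cong (a ^_) (sym (ℕ.+-∸-assoc 1 c≤M))))))

  -- Rooted trees

  module Trees (a b : Carrier) (k : ℕ) where
    open Forests a b (suc k)

    treeWeight : (Fin (suc k) → Fin (suc k)) → Carrier
    treeWeight f = a ^ (suc k ∸ prop (suc k) f) * b ^ (prop (suc k) f ∸ 1)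

    zero-proper : ∀ f → IsProper (suc k) f Fin.zero
    zero-proper f Fin.zero    _ 0≢0 = contradiction refl 0≢0
    zero-proper f (Fin.suc _) _ _   = s≤s z≤n

    treeWeight≈weight : ∀ f → treeWeight f ≈ weight (const false) f
    treeWeight≈weight f = begin
      a ^ (suc k ∸ prop (suc k) f) * b ^ (prop (suc k) f ∸ 1)
        ≡⟨ cong (λ p → a ^ (suc k ∸ p) * b ^ (p ∸ 1)) prop≡1+#proper ⟩
      a ^ (k ∸ #proper) * b ^ #proper
        ≈⟨ prod-propernessWeight (λ v → isProper? (suc k) f (Fin.suc v)) ⟨
      prod (λ v → propernessWeight (isProper? (suc k) f (Fin.suc v)))
        ≈⟨ *-identityˡ _ ⟨
      weight (const false) f ∎
      where
      #proper : ℕ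
      #proper = count (λ v → does (isProper? (suc k) f (Fin.suc v)))
      prop≡1+#proper : prop (suc k) f ≡ suc #proper
      prop≡1+#proper = trans (length-filter-tabulate (isProper? (suc k) f) (λ v → v))
                       (cong (λ β → indicator β ℕ.+ #proper)
                             (Dec.dec-true (isProper? (suc k) f Fin.zero) (zero-proper f)))

    singleton : Fin (suc k) → Fin (suc k) → Bool
    singleton r = insert (const false) r

    ∈singleton : ∀ {r v} → singleton r v ≡ true → v ≡ r
    ∈singleton {r} {v} v∈ with v Fin.≟ r
    ... | yes v≡r = v≡r
    ... | no  v≢r = contradiction (trans (sym (insert-≢ (const false) v≢r)) v∈) λ ()

    count-singleton : ∀ r → count (singleton r) ≡ 1
    count-singleton r = trans (count-insert (const false) {r} refl) (cong suc (count-false (suc k)))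

    count-not-singleton : ∀ r → count (not ∘ singleton r) ≡ k
    count-not-singleton r = ℕ.suc-injective (trans (sym (count-not-insert (const false) {r} refl)) (count-true (suc k)))

    IsTreeRootedAt : Fin (suc k) → (Fin (suc k) → Fin (suc k)) → Set
    IsTreeRootedAt r f = f r ≡ r × (∀ v → iter f (suc k) v ≡ r)

    forest⇒tree : ∀ {r f} → IsForest (singleton r) f → IsTreeRootedAt r f
    forest⇒tree {r} (fixed , reach) = fixed r (insert-self (const false) r) , ∈singleton ∘ reach

    tree⇒forest : ∀ {r f} → IsTreeRootedAt r f → IsForest (singleton r) f
    tree⇒forest {r} {f} (fr≡r , reach) =
      (λ s s∈ → subst (λ u → f u ≡ u) (sym (∈singleton s∈)) fr≡r) ,
      (λ v → trans (cong (singleton r) (reach v)) (insert-self (const false) r))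

    rootWeight : Fin (suc k) → Carrier
    rootWeight Fin.zero    = 1#
    rootWeight (Fin.suc _) = a

    nonRootWeight-root : ∀ f {r} → (∀ v → iter f (suc k) v ≡ r) → nonRootWeight f r ≈ rootWeight r
    nonRootWeight-root f {Fin.zero}       _     = ≈-refl
    nonRootWeight-root f {r@(Fin.suc _)} reach with isProper? (suc k) f r
    ... | yes proper = contradiction (proper Fin.zero (descendant ℕ.≤-refl (reach Fin.zero)) λ ()) λ ()
    ... | no  _      = ≈-refl

    treeWeight-by-root : ∀ f → when (isRootedTree? (suc k) f) (treeWeight f) ≈
                         ∑[ r < suc k ] (rootWeight r * when (isForest? (singleton r) f) (weight (singleton r) f))
    treeWeight-by-root f = when-elim (isRootedTree? (suc k) f)
      (λ (r , tree@(_ , reach)) → begin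
        treeWeight f
          ≈⟨ treeWeight≈weight f ⟩
        weight (const false) f
          ≈⟨ weight-insert (const false) f {r} refl ⟩
        nonRootWeight f r * weight (singleton r) f
          ≈⟨ *-congʳ (nonRootWeight-root f reach) ⟩
        rootWeight r * weight (singleton r) f
          ≈⟨ *-congˡ (when-yes (isForest? (singleton r) f) (tree⇒forest tree)) ⟨
        rootWeight r * when (isForest? (singleton r) f) (weight (singleton r) f)
          ≈⟨ sum-single +-commutativeMonoid _ r (λ r′ r′≢r → ≈-trans
               (*-congˡ (when-no (isForest? (singleton r′) f) {weight (singleton r′) f}
                 (λ forest′ → r′≢r (trans (sym (proj₂ (forest⇒tree forest′) r)) (reach r)))))
               (zeroʳ (rootWeight r′))) ⟨
        ∑[ r′ < suc k ] (rootWeight r′ * when (isForest? (singleton r′) f) (weight (singleton r′) f)) ∎)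
      (λ ¬tree → ≈-sym (sum-zero +-commutativeMonoid _ (λ r →
        ≈-trans (*-congˡ (when-no (isForest? (singleton r) f) {weight (singleton r) f}
                                  (λ forest → ¬tree (r , forest⇒tree forest))))
                (zeroʳ (rootWeight r)))))

    treeSum≈∑forestSum : treeSum R (suc k) a b ≈ ∑[ r < suc k ] (rootWeight r * forestSum (singleton r))
    treeSum≈∑forestSum = begin
      treeSum R (suc k) a b
        ≈⟨ listSum-filter (isRootedTree? (suc k)) treeWeight (allFuns (suc k) (suc k)) ⟩
      ∑ R (map (λ f → when (isRootedTree? (suc k) f) (treeWeight f)) (allFuns (suc k) (suc k)))
        ≈⟨ listSum-allFuns (suc k) (suc k) _ ⟩
      funSum (λ f → when (isRootedTree? (suc k) f) (treeWeight f))
        ≈⟨ funSum-cong treeWeight-by-root ⟩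
      funSum (λ f → ∑[ r < suc k ] (rootWeight r * when (isForest? (singleton r) f) (weight (singleton r) f)))
        ≈⟨ funSum-∑-comm (λ r f → rootWeight r * when (isForest? (singleton r) f) (weight (singleton r) f)) ⟩
      ∑[ r < suc k ] funSum (λ f → rootWeight r * when (isForest? (singleton r) f) (weight (singleton r) f))
        ≈⟨ sum-cong-≋ (λ r → *-distribˡ-funSum (rootWeight r)
                               (λ f → when (isForest? (singleton r) f) (weight (singleton r) f))) ⟨
      ∑[ r < suc k ] (rootWeight r * forestSum (singleton r)) ∎

  treeSum-formula : ∀ a b k → treeSum R (suc k) a b ≈ Forests.forestProduct a b (suc k) k 0
  treeSum-formula a b zero = begin
    treeSum R 1 a b
      ≈⟨ treeSum≈∑forestSum ⟩
    1# * forestSum (singleton Fin.zero) + 0#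
      ≈⟨ ≈-trans (+-identityʳ _) (*-identityˡ _) ⟩
    forestSum (singleton Fin.zero)
      ≈⟨ forestSum-all-roots (singleton Fin.zero) (λ { Fin.zero → insert-self {1} (const false) Fin.zero }) ⟩
    1# ∎
    where
    open Forests a b 1
    open Trees a b 0
  treeSum-formula a b (suc k) = begin
    treeSum R (suc (suc k)) a b
      ≈⟨ treeSum≈∑forestSum ⟩
    1# * forestSum (singleton Fin.zero) + ∑[ r < suc k ] (a * forestSum (singleton (Fin.suc r)))
      ≈⟨ +-cong (*-congˡ (forestSum-singleton Fin.zero (Fin.suc Fin.zero) least₀))
                (sum-cong-≋ (λ r → *-congˡ {a} (forestSum-singleton (Fin.suc r) Fin.zero (leastₛ r)))) ⟩
    1# * (1 ·ℕ (b * F)) + ∑[ r < suc k ] (a * (1 ·ℕ (1# * F)))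
      ≈⟨ +-congˡ (≈-trans (sum-replicate (suc k)) (×-congʳ (suc k) (*-congˡ (×-homo-1 (1# * F))))) ⟩
    1# * (1 ·ℕ (b * F)) + suc k ·ℕ (a * (1# * F))
      ≈⟨ collect-× 1# a b F 1 (suc k) ⟩
    1# * forestProduct (suc k) 0
      ≈⟨ *-identityˡ _ ⟩
    forestProduct (suc k) 0 ∎
    where
    open Forests a b (suc (suc k))
    open Trees a b (suc k)
    F : Carrier
    F = forestProduct k 1
    forestSum-singleton : ∀ r m → IsLeastOutside (singleton r) m →
                          forestSum (singleton r) ≈ 1 ·ℕ (properWeight m * F)
    forestSum-singleton r m least = ≈-trans (forestSum-formula k least (count-not-singleton r))
      (reflexive (cong (λ t → t ·ℕ (properWeight m * forestProduct k t)) (count-singleton r)))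
    least₀ : IsLeastOutside (singleton Fin.zero) (Fin.suc Fin.zero)
    least₀ = insert-≢ {suc (suc k)} (const false) {Fin.zero} {Fin.suc Fin.zero} (λ ()) ,
             λ { Fin.zero 0∉S → contradiction (trans (sym (insert-self {suc (suc k)} (const false) Fin.zero)) 0∉S) λ ()
               ; (Fin.suc v) _ → s≤s z≤n }
    leastₛ : ∀ r → IsLeastOutside (singleton (Fin.suc r)) Fin.zero
    leastₛ r = insert-≢ (const false) {Fin.suc r} {Fin.zero} (λ ()) , λ _ _ → z≤n

corollary6p2 : {c ℓ : Level} (R : CommutativeSemiring c ℓ) (n : ℕ) → n ≥ 1 →
    (a b : CommutativeSemiring.Carrier R) →
    CommutativeSemiring._≈_ R (treeSum R n a b) (Q R n a b)
corollary6p2 R (suc k) _ a b =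
  CommutativeSemiring.trans R (treeSum-formula R a b k) (Forests.forestProduct≈∏ R a b (suc k) k 0)
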